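{- Let $G$ be a finite connected graph with diameter at most $3$ that has two vertices $u,v$ of degree $1$ with a common neighbor, and let $t$ be a vertex with $d(u,t)=d(v,t)=2$. Then $G$ is not $t$-stackable.
   Context: Cup stacking on a finite connected graph $G$: initially one cup on every vertex; a move takes all $r\ge1$ cups from a vertex $x$ onto a vertex $y\neq x$ that already carries at least one cup and satisfies $d(x,y)=r$ (shortest-path distance in $G$). $G$ is $t$-stackable if some sequence of moves ends with all cups on $t$. -}

module Defs where

open import Level using (0ℓ)
open import Data.Nat using (ℕ; zero; suc; _≤_; _<_)
open import Data.Fin using (Fin)
open import Data.Product using (Σ; ∃; ∃-syntax; _×_)
open import Relation.Nullary using (¬_)
open import Relation.Binary.PropositionalEquality using (_≡_; _≢_)
open import Relation.Binary.Construct.Closure.ReflexiveTransitive using (Star)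

record Graph (n : ℕ) : Set₁ where
  field
    Adj     : Fin n → Fin n → Set
    sym     : ∀ {x y} → Adj x y → Adj y x
    irrefl  : ∀ {x} → ¬ Adj x x

module _ {n : ℕ} (G : Graph n) where
  open Graph G

  data Walk : Fin n → Fin n → ℕ → Set where
    here  : ∀ {x} → Walk x x zero
    step  : ∀ {x y z k} → Adj x y → Walk y z k → Walk x z (suc k)

  Dist : Fin n → Fin n → ℕ → Set
  Dist x y r = Walk x y r × (∀ k → k < r → ¬ Walk x y k)

  Connected : Set
  Connected = ∀ x y → ∃[ k ] Walk x y k

  DiamAtMost : ℕ → Set
  DiamAtMost d = ∀ x y → ∃[ k ] (k ≤ d × Walk x y k)

  Leaf : Fin n → Fin n → Set
  Leaf u w = Adj u w × (∀ z → Adj u z → z ≡ w)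

  -- cup configurations: number of cups on each vertex
  Config : Set
  Config = Fin n → ℕ

  initial : Config
  initial _ = 1

  Move : Config → Config → Set
  Move c c' = ∃[ x ] ∃[ y ]
    ( x ≢ y × 1 ≤ c x × 1 ≤ c y × Dist x y (c x)
    × c' x ≡ 0 × c' y ≡ c y Data.Nat.+ c x
    × (∀ z → z ≢ x → z ≢ y → c' z ≡ c z))

  AllOn : Fin n → Config → Set
  AllOn t c = ∀ x → x ≢ t → c x ≡ 0

  Stackable : Fin n → Set
  Stackable t = ∃[ c ] (Star Move initial c × AllOn t c)

{-# OPTIONS --safe #-}
module Submission where

-- Two facts drive the argument. A vertex z is stuck once its number of cups exceeds every
-- distance from z: these cups can never be moved again. And an empty vertex never receives cups.
-- With diameter at most 3, four cups are stuck anywhere, and three cups are stuck on the common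
-- neighbour w of the leaves u and v, whose eccentricity is at most 2. A leaf sends only a single
-- cup, to w, and receives either a single cup from w or at least two cups from farther away;
-- three cups on a leaf at distance 2 from t can only go to a vertex at distance 3, which is not t
-- and then holds a stuck pile. So unless some pile is doomed, the star {u, v, w} keeps at least
-- three cups, at most two of them on w; once w is emptied, a leaf is left with a single cup it
-- can never move.

open import Defs
open import Data.Nat using (ℕ; zero; suc; _+_; _≤_; _<_; z≤n; s≤s; _≤?_)
open import Data.Nat.Properties using (≤-refl; ≤-reflexive; ≤-trans; ≤-antisym; <-irrefl; ≤-<-trans; <-≤-trans; ≰⇒>; <-cmp; m≤m+n; +-mono-≤; +-comm; +-assoc)
open import Data.Fin using (Fin)
open import Data.Fin.Properties using (_≟_)
open import Data.Product using (_×_; _,_; proj₁; proj₂)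
open import Data.Sum using (_⊎_; inj₁; inj₂; [_,_])
open import Data.Empty using (⊥-elim)
open import Relation.Nullary using (¬_; yes; no; contradiction)
open import Relation.Binary using (tri<; tri≈; tri>)
open import Relation.Binary.PropositionalEquality using (_≡_; _≢_; refl; sym; trans; cong; cong₂; subst; ≢-sym; module ≡-Reasoning)
open import Relation.Binary.Construct.Closure.ReflexiveTransitive using (Star; ε; _◅_)

last-leaf-single : ∀ {a b} → a ≤ 1 → b ≤ 1 → 3 ≤ a + b + 1 → b ≡ 1
last-leaf-single _ (s≤s z≤n) _ = refl
last-leaf-single z≤n z≤n (s≤s ())
last-leaf-single (s≤s z≤n) z≤n (s≤s (s≤s ()))

some-leaf-single : ∀ {a b k} → a ≤ 1 → b ≤ 1 → k ≤ 2 → 3 ≤ a + b + k → a ≡ 1 ⊎ b ≡ 1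
some-leaf-single (s≤s z≤n) _ _ _ = inj₁ refl
some-leaf-single z≤n (s≤s z≤n) _ _ = inj₂ refl
some-leaf-single z≤n z≤n k≤2 3≤k = contradiction (≤-trans 3≤k k≤2) λ { (s≤s (s≤s ())) }

+-rotate-first-to-last : ∀ a b k → a + b + k ≡ 0 + b + (k + a)
+-rotate-first-to-last a b k = begin
  a + b + k    ≡⟨ cong (_+ k) (+-comm a b) ⟩
  b + a + k    ≡⟨ +-assoc b a k ⟩
  b + (a + k)  ≡⟨ cong (b +_) (+-comm a k) ⟩
  b + (k + a)  ∎
  where open ≡-Reasoning

source target : ∀ {n} {G : Graph n} {c c' : Config G} → Move G c c' → Fin n
source = proj₁
target m = proj₁ (proj₂ m)

module _ {n : ℕ} (G : Graph n) where
  open Graph G using (Adj; irrefl) renaming (sym to adj-sym)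

  private variable
    x y z ℓ w : Fin n
    r s k : ℕ
    c c' : Config G

  dist-unique : Dist G x y r → Dist G x y s → r ≡ s
  dist-unique {r = r} {s = s} (wr , min-r) (ws , min-s) with <-cmp r s
  ... | tri< r<s _ _ = contradiction wr (min-s r r<s)
  ... | tri≈ _ r≡s _ = r≡s
  ... | tri> _ _ s<r = contradiction ws (min-r s s<r)

  dist-≤-walk : Dist G x y r → Walk G x y k → r ≤ k
  dist-≤-walk {r = r} {k = k} (_ , min-r) wk with r ≤? k
  ... | yes r≤k = r≤k
  ... | no r≰k = contradiction wk (min-r k (≰⇒> r≰k))

  dist-≤-diam : DiamAtMost G k → Dist G x y r → r ≤ k
  dist-≤-diam {x = x} {y = y} diam d with diam x y
  ... | _ , l≤k , wl = ≤-trans (dist-≤-walk d wl) l≤k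

  dist-refl : Dist G x x 0
  dist-refl = here , λ _ ()

  dist-suc⇒≢ : Dist G x y (suc r) → x ≢ y
  dist-suc⇒≢ (_ , min) refl = min 0 (s≤s z≤n) here

  adj⇒dist-1 : Adj x y → Dist G x y 1
  adj⇒dist-1 a = step a here , λ { zero _ here → irrefl a ; (suc _) (s≤s ()) _ }

  leaf-dist-1 : Leaf G ℓ w → Dist G ℓ y 1 → y ≡ w
  leaf-dist-1 (_ , only-w) (step a here , _) = only-w _ a

  leaf≢neighbour : Leaf G ℓ w → ℓ ≢ w
  leaf≢neighbour (a , _) refl = irrefl a

  walk-to-leaf-≥2 : Leaf G ℓ w → x ≢ ℓ → x ≢ w → Walk G x ℓ r → 2 ≤ r
  walk-to-leaf-≥2 _ x≢ℓ _ here = contradiction refl x≢ℓ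
  walk-to-leaf-≥2 (_ , only-w) _ x≢w (step a here) = contradiction (only-w _ (adj-sym a)) x≢w
  walk-to-leaf-≥2 _ _ _ (step _ (step _ _)) = s≤s (s≤s z≤n)

  leaf-neighbour-ecc : DiamAtMost G (suc (suc k)) → Leaf G ℓ w → Dist G w y r → r ≤ suc k
  leaf-neighbour-ecc {ℓ = ℓ} {y = y} diam (a , only-w) d with diam ℓ y
  ... | _ , _ , here = ≤-trans (dist-≤-walk d (step (adj-sym a) here)) (s≤s z≤n)
  ... | suc l , s≤s l≤ , step b wl with only-w _ b
  ...   | refl = ≤-trans (dist-≤-walk d wl) l≤

  move-mono : (m : Move G c c') → z ≢ source m → c z ≤ c' z
  move-mono {c = c} {z = z} (x , y , _ , _ , _ , _ , _ , gain-y , frame) z≢x with z ≟ y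
  ... | yes refl = subst (c z ≤_) (sym gain-y) (m≤m+n (c z) (c x))
  ... | no z≢y = subst (c z ≤_) (sym (frame z z≢x z≢y)) ≤-refl

  empty-stays-empty : Move G c c' → c z ≡ 0 → c' z ≡ 0
  empty-stays-empty {c = c} {z = z} (x , y , _ , occ-x , occ-y , _ , _ , _ , frame) cz≡0 =
    trans (frame z (λ { refl → unoccupied occ-x }) (λ { refl → unoccupied occ-y })) cz≡0
    where
    unoccupied : ¬ 1 ≤ c z
    unoccupied occ = contradiction (subst (1 ≤_) cz≡0 occ) λ ()

  move-onto-leaf-overloads : Leaf G ℓ w → (m : Move G c c') → target m ≡ ℓ → source m ≢ w → 3 ≤ c' ℓ
  move-onto-leaf-overloads L (x , y , x≢y , _ , occ-y , dxy , _ , gain-y , _) refl x≢w =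
    subst (3 ≤_) (sym gain-y) (+-mono-≤ occ-y (walk-to-leaf-≥2 L x≢y x≢w (proj₁ dxy)))

  record Stuck (c : Config G) (z : Fin n) : Set where
    constructor exceeds
    field exceeds-dist : ∀ {y r} → Dist G z y r → r < c z

  stuck-occupied : Stuck c z → 1 ≤ c z
  stuck-occupied (exceeds st) = st dist-refl

  stuck-step : Move G c c' → Stuck c z → Stuck c' z
  stuck-step {z = z} m@(x , _ , _ , _ , _ , dxy , _) (exceeds st) with z ≟ x
  ... | yes refl = ⊥-elim (<-irrefl refl (st dxy))
  ... | no z≢x = exceeds λ d → <-≤-trans (st d) (move-mono m z≢x)

  beyond-diam-stuck : DiamAtMost G k → k < c z → Stuck c z
  beyond-diam-stuck diam k<cz = exceeds λ d → ≤-<-trans (dist-≤-diam diam d) k<cz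

module _ {n : ℕ} {G : Graph n} (diam : DiamAtMost G 3) (t : Fin n) where

  private variable
    z : Fin n
    c c' : Config G

  data Doomed (c : Config G) : Set where
    stuck      : z ≢ t → Stuck G c z → Doomed c
    overloaded : Dist G z t 2 → 3 ≤ c z → Doomed c

  doomed-step : Move G c c' → Doomed c → Doomed c'
  doomed-step m (stuck z≢t st) = stuck z≢t (stuck-step G m st)
  doomed-step {c = c} {c' = c'} m@(x , y , _ , _ , occ-y , dxy , _ , gain-y , _)
              (overloaded {z} dzt 3≤cz) with z ≟ x
  ... | no z≢x = overloaded dzt (≤-trans 3≤cz (move-mono G m z≢x))
  ... | yes refl = stuck y≢t (beyond-diam-stuck G diam 3<c'y)
    where
    cz≡3 : c z ≡ 3
    cz≡3 = ≤-antisym (dist-≤-diam G diam dxy) 3≤cz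
    y≢t : y ≢ t
    y≢t refl = contradiction (dist-unique G (subst (Dist G z t) cz≡3 dxy) dzt) λ ()
    3<c'y : 3 < c' y
    3<c'y = subst (3 <_) (sym gain-y) (+-mono-≤ occ-y 3≤cz)

  doomed-final : Doomed c → ¬ AllOn G t c
  doomed-final (stuck {z} z≢t st) all-on-t =
    contradiction (subst (1 ≤_) (all-on-t z z≢t) (stuck-occupied G st)) λ ()
  doomed-final (overloaded {z} dzt 3≤cz) all-on-t =
    contradiction (subst (3 ≤_) (all-on-t z (dist-suc⇒≢ G dzt)) 3≤cz) λ ()

module _ {n : ℕ} {G : Graph n} (diam : DiamAtMost G 3) (t w : Fin n) where

  private variable
    ℓ ℓ' : Fin n
    c c' : Config G

  Pendant : Fin n → Set
  Pendant ℓ = Leaf G ℓ w × Dist G ℓ t 2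

  record Cherry (ℓ ℓ' : Fin n) : Set where
    field
      left     : Pendant ℓ
      right    : Pendant ℓ'
      distinct : ℓ ≢ ℓ'

  cherry-swap : Cherry ℓ ℓ' → Cherry ℓ' ℓ
  cherry-swap K = record { left = right ; right = left ; distinct = ≢-sym distinct }
    where open Cherry K

  -- With at most two cups on the hub and at least three on the star, emptying the hub leaves a leaf
  -- with a single cup behind.
  record Live (c : Config G) (ℓ ℓ' : Fin n) : Set where
    field
      left≤1  : c ℓ ≤ 1
      right≤1 : c ℓ' ≤ 1
      hub≤2   : c w ≤ 2
      3≤star  : 3 ≤ c ℓ + c ℓ' + c w

  live-swap : Live c ℓ ℓ' → Live c ℓ' ℓ
  live-swap {c = c} {ℓ} {ℓ'} L = record
    { left≤1 = right≤1 ; right≤1 = left≤1 ; hub≤2 = hub≤2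
    ; 3≤star = subst (3 ≤_) (cong (_+ c w) (+-comm (c ℓ) (c ℓ'))) 3≤star }
    where open Live L

  pendant≢t : Pendant ℓ → ℓ ≢ t
  pendant≢t (_ , dℓt) = dist-suc⇒≢ G dℓt

  hub≢t : Pendant ℓ → w ≢ t
  hub≢t ((a , _) , _ , min) refl = min 1 (s≤s (s≤s z≤n)) (step a here)

  hub-stuck : Leaf G ℓ w → 3 ≤ c w → Stuck G c w
  hub-stuck L 3≤cw = exceeds λ d → ≤-<-trans (leaf-neighbour-ecc G diam L d) 3≤cw

  data Invariant (c : Config G) : Set where
    doomed   : Doomed diam t c → Invariant c
    stranded : Pendant ℓ → c w ≡ 0 → c ℓ ≡ 1 → Invariant c
    live     : Cherry ℓ ℓ' → Live c ℓ ℓ' → Invariant c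

  stranded-step : Leaf G ℓ w → Move G c c' → c w ≡ 0 → c ℓ ≡ 1 → (c' w ≡ 0 × c' ℓ ≡ 1) ⊎ 3 ≤ c' ℓ
  stranded-step {ℓ = ℓ} {c = c} L m@(x , y , _ , occ-x , occ-y , dxy , _ , _ , frame) cw≡0 cℓ≡1
    with ℓ ≟ x | ℓ ≟ y
  ... | yes refl | _ = contradiction (subst (1 ≤_) cw≡0 (subst (λ v → 1 ≤ c v) y≡w occ-y)) λ ()
    where
    y≡w : y ≡ w
    y≡w = leaf-dist-1 G L (subst (Dist G ℓ y) cℓ≡1 dxy)
  ... | no _ | yes refl = inj₂ (move-onto-leaf-overloads G L m refl x≢w)
    where
    x≢w : x ≢ w
    x≢w refl = contradiction (subst (1 ≤_) cw≡0 occ-x) λ ()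
  ... | no ℓ≢x | no ℓ≢y = inj₁ (empty-stays-empty G m cw≡0 , trans (frame ℓ ℓ≢x ℓ≢y) cℓ≡1)

  live-unless-hub-stuck : Cherry ℓ ℓ' → c ℓ ≤ 1 → c ℓ' ≤ 1 → 3 ≤ c ℓ + c ℓ' + c w → Invariant c
  live-unless-hub-stuck {c = c} K ℓ≤1 ℓ'≤1 3≤star with c w ≤? 2
  ... | yes w≤2 = live K (record { left≤1 = ℓ≤1 ; right≤1 = ℓ'≤1 ; hub≤2 = w≤2 ; 3≤star = 3≤star })
  ... | no w≰2 = doomed (stuck (hub≢t left) (hub-stuck (proj₁ left) (≰⇒> w≰2)))
    where open Cherry K

  leaf-source-step : (m : Move G c c') → source m ≡ ℓ → Cherry ℓ ℓ' → Live c ℓ ℓ' → Invariant c'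
  leaf-source-step {c = c} {c' = c'} {ℓ = ℓ} {ℓ' = ℓ'}
    (x , y , _ , occ-x , _ , dxy , empty-x , gain-y , frame) refl K L =
    live-unless-hub-stuck K (subst (_≤ 1) (sym empty-x) z≤n) (subst (_≤ 1) (sym c'ℓ'≡cℓ') right≤1)
      (subst (3 ≤_) star-preserved 3≤star)
    where
    open Cherry K
    open Live L
    y≡w : y ≡ w
    y≡w = leaf-dist-1 G (proj₁ left) (subst (Dist G ℓ y) (≤-antisym left≤1 occ-x) dxy)
    c'ℓ'≡cℓ' : c' ℓ' ≡ c ℓ'
    c'ℓ'≡cℓ' = frame ℓ' (≢-sym distinct) λ ℓ'≡y → leaf≢neighbour G (proj₁ right) (trans ℓ'≡y y≡w)
    c'w≡ : c' w ≡ c w + c ℓ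
    c'w≡ = subst (λ v → c' v ≡ c v + c ℓ) y≡w gain-y
    star-preserved : c ℓ + c ℓ' + c w ≡ c' ℓ + c' ℓ' + c' w
    star-preserved = begin
      c ℓ + c ℓ' + c w          ≡⟨ +-rotate-first-to-last (c ℓ) (c ℓ') (c w) ⟩
      0 + c ℓ' + (c w + c ℓ)    ≡⟨ cong₂ (λ e v → e + c ℓ' + v) (sym empty-x) (sym c'w≡) ⟩
      c' ℓ + c ℓ' + c' w        ≡⟨ cong (λ v → c' ℓ + v + c' w) (sym c'ℓ'≡cℓ') ⟩
      c' ℓ + c' ℓ' + c' w       ∎
      where open ≡-Reasoning

  hub-strands : (m : Move G c c') → source m ≡ w → Pendant ℓ → ℓ ≢ target m → c ℓ ≡ 1 → Invariant c'
  hub-strands (_ , _ , _ , _ , _ , _ , empty-x , _ , frame) refl P ℓ≢y cℓ≡1 =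
    stranded P empty-x (trans (frame _ (leaf≢neighbour G (proj₁ P)) ℓ≢y) cℓ≡1)

  hub-onto-leaf : (m : Move G c c') → source m ≡ w → target m ≡ ℓ →
                  Cherry ℓ ℓ' → Live c ℓ ℓ' → Invariant c'
  hub-onto-leaf {c = c} {ℓ = ℓ} {ℓ' = ℓ'} m@(_ , _ , _ , _ , _ , dwℓ , _) refl refl K L =
    hub-strands m refl right (≢-sym distinct)
      (last-leaf-single left≤1 right≤1 (subst (λ k → 3 ≤ c ℓ + c ℓ' + k) cw≡1 3≤star))
    where
    open Cherry K
    open Live L
    cw≡1 : c w ≡ 1
    cw≡1 = dist-unique G dwℓ (adj⇒dist-1 G (Graph.sym G (proj₁ (proj₁ left))))

  hub-source-step : (m : Move G c c') → source m ≡ w → Cherry ℓ ℓ' → Live c ℓ ℓ' → Invariant c'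
  hub-source-step {ℓ = ℓ} {ℓ' = ℓ'} m@(_ , y , _) x≡w K L with y ≟ ℓ | y ≟ ℓ'
  ... | yes y≡ℓ | _ = hub-onto-leaf m x≡w y≡ℓ K L
  ... | no _ | yes y≡ℓ' = hub-onto-leaf m x≡w y≡ℓ' (cherry-swap K) (live-swap L)
  ... | no y≢ℓ | no y≢ℓ' =
    [ hub-strands m x≡w (Cherry.left K) (≢-sym y≢ℓ)
    , hub-strands m x≡w (Cherry.right K) (≢-sym y≢ℓ') ]
      (some-leaf-single left≤1 right≤1 hub≤2 3≤star)
    where open Live L

  outer-onto-pendant : (m : Move G c c') → w ≢ source m → target m ≡ ℓ → Pendant ℓ → Invariant c'
  outer-onto-pendant m w≢x y≡ℓ (L , dℓt) =
    doomed (overloaded dℓt (move-onto-leaf-overloads G L m y≡ℓ (≢-sym w≢x)))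

  outer-source-step : (m : Move G c c') → ℓ ≢ source m → ℓ' ≢ source m → w ≢ source m →
                      Cherry ℓ ℓ' → Live c ℓ ℓ' → Invariant c'
  outer-source-step {c = c} {c' = c'} {ℓ = ℓ} {ℓ' = ℓ'}
    m@(x , y , _ , _ , _ , _ , _ , _ , frame) ℓ≢x ℓ'≢x w≢x K L with ℓ ≟ y | ℓ' ≟ y
  ... | yes ℓ≡y | _ = outer-onto-pendant m w≢x (sym ℓ≡y) (Cherry.left K)
  ... | no _ | yes ℓ'≡y = outer-onto-pendant m w≢x (sym ℓ'≡y) (Cherry.right K)
  ... | no ℓ≢y | no ℓ'≢y =
    live-unless-hub-stuck K (subst (_≤ 1) (sym c'ℓ≡cℓ) left≤1) (subst (_≤ 1) (sym c'ℓ'≡cℓ') right≤1)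
      (≤-trans 3≤star (+-mono-≤ (≤-reflexive (sym (cong₂ _+_ c'ℓ≡cℓ c'ℓ'≡cℓ')))
                                (move-mono G m w≢x)))
    where
    open Live L
    c'ℓ≡cℓ : c' ℓ ≡ c ℓ
    c'ℓ≡cℓ = frame ℓ ℓ≢x ℓ≢y
    c'ℓ'≡cℓ' : c' ℓ' ≡ c ℓ'
    c'ℓ'≡cℓ' = frame ℓ' ℓ'≢x ℓ'≢y

  live-step : Move G c c' → Cherry ℓ ℓ' → Live c ℓ ℓ' → Invariant c'
  live-step {ℓ = ℓ} {ℓ' = ℓ'} m@(x , _) K L with x ≟ ℓ | x ≟ ℓ' | x ≟ w
  ... | yes x≡ℓ | _ | _ = leaf-source-step m x≡ℓ K L
  ... | no _ | yes x≡ℓ' | _ = leaf-source-step m x≡ℓ' (cherry-swap K) (live-swap L)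
  ... | no _ | no _ | yes x≡w = hub-source-step m x≡w K L
  ... | no x≢ℓ | no x≢ℓ' | no x≢w = outer-source-step m (≢-sym x≢ℓ) (≢-sym x≢ℓ') (≢-sym x≢w) K L

  inv-step : Move G c c' → Invariant c → Invariant c'
  inv-step m (doomed D) = doomed (doomed-step diam t m D)
  inv-step m (stranded P cw≡0 cℓ≡1) with stranded-step (proj₁ P) m cw≡0 cℓ≡1
  ... | inj₁ (c'w≡0 , c'ℓ≡1) = stranded P c'w≡0 c'ℓ≡1
  ... | inj₂ 3≤c'ℓ = doomed (overloaded (proj₂ P) 3≤c'ℓ)
  inv-step m (live K L) = live-step m K L

  inv-steps : Star (Move G) c c' → Invariant c → Invariant c'
  inv-steps ε I = I
  inv-steps (m ◅ ms) I = inv-steps ms (inv-step m I)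

  inv-final : Invariant c → ¬ AllOn G t c
  inv-final (doomed D) all-on-t = doomed-final diam t D all-on-t
  inv-final (stranded {ℓ} P _ cℓ≡1) all-on-t =
    contradiction (trans (sym cℓ≡1) (all-on-t ℓ (pendant≢t P))) λ ()
  inv-final {c} (live {ℓ} {ℓ'} K L) all-on-t = contradiction (subst (3 ≤_) star-empty 3≤star) λ ()
    where
    open Cherry K
    open Live L
    star-empty : c ℓ + c ℓ' + c w ≡ 0
    star-empty = cong₂ _+_ (cong₂ _+_ (all-on-t ℓ (pendant≢t left)) (all-on-t ℓ' (pendant≢t right)))
                           (all-on-t w (hub≢t left))

lemma4p5 : (n : ℕ) (G : Graph n) → Connected G → DiamAtMost G 3 →
    (u v w t : Fin n) → u ≢ v → Leaf G u w → Leaf G v w →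
    Dist G u t 2 → Dist G v t 2 → ¬ Stackable G t
lemma4p5 n G _ diam u v w t u≢v Lu Lv du dv (c , moves , all-on-t) =
  inv-final diam t w (inv-steps diam t w moves initially-live) all-on-t
  where
  initially-live : Invariant diam t w (initial G)
  initially-live =
    live (record { left = Lu , du ; right = Lv , dv ; distinct = u≢v })
         (record { left≤1 = ≤-refl ; right≤1 = ≤-refl ; hub≤2 = s≤s z≤n ; 3≤star = ≤-refl })
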